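{- Let $\Sigma$ be a monoidal signature. Every morphism in the image of the composite $[\![[\mathcal{I},\mathcal{C}](-)]\!]:\mathbf{STMC}(\Sigma)+\mathbf{CComon}\to\mathrm{Csp}_D(\mathbf{Hyp}_\Sigma)$ is a partial left-monogamous cospan, i.e. lies in $\mathsf{PLM}\,\mathrm{Csp}_D(\mathbf{Hyp}_\Sigma)$.
   Context: A monoidal signature $\Sigma$ is a set of generators each with an arity and coarity in $\mathbb{N}$. A hypergraph $F$ has a set $F_\star$ of vertices and sets $F_{k,l}$ of hyperedges with ordered source maps $s_i$ ($i<k$) and target maps $t_j$ ($j<l$) into $F_\star$; $\mathbf{Hyp}_\Sigma$ is the category of hypergraphs whose hyperedges in $F_{k,l}$ are labelled by generators of arity $k$ and coarity $l$. The discrete hypergraph $n$ has $n$ vertices and no hyperedges. $\mathrm{Csp}_D(\mathbf{Hyp}_\Sigma)$ is the PROP whose morphisms $m\to n$ are isomorphism classes of cospans $m\to F\leftarrow n$ in $\mathbf{Hyp}_\Sigma$, composition by pushout, tensor by disjoint union. It has the Frobenius structure of discrete cospans merge $n+n\to n\leftarrow n$, unit $0\to n\leftarrow n$, copy $n\to n\leftarrow n+n$, counit $n\to n\leftarrow 0$. The in-degree of a vertex $v$ is the number of pairs $(e,j)$ with $v=t_j(e)$. A cospan $m\xrightarrow{f}F\xleftarrow{g}n$ is partial left-monogamous if $f$ is injective, every vertex in the image of $f$ has in-degree $0$ and every other vertex has in-degree $0$ or $1$. $\mathbf{STMC}(\Sigma)$ is the free symmetric traced monoidal PROP on $\Sigma$;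 $\mathbf{CComon}$ is the PROP of commutative comonoids (generators copy $1\to2$ and discard $1\to0$ subject to coassociativity, counitality and cocommutativity); $\mathbf{STMC}(\Sigma)+\mathbf{CComon}$ is their combination (coproduct). $\mathbf{SMC}(\Sigma)+\mathbf{Frob}$ is the coproduct of the free symmetric monoidal PROP on $\Sigma$ and the PROP $\mathbf{Frob}$ of special commutative Frobenius algebras (generators merge, unit, copy, counit); it is compact closed with cup $=$ unit;copy, cap $=$ merge;counit and canonical trace $\mathrm{Tr}^x(h)=(\mathrm{cup}_x\otimes\mathrm{id}_m);(\mathrm{id}_x\otimes h);(\mathrm{cap}_x\otimes\mathrm{id}_n)$. $\mathcal{I}:\mathbf{STMC}(\Sigma)\to\mathbf{SMC}(\Sigma)+\mathbf{Frob}$ sends generators to themselves and the trace to the canonical trace; $\mathcal{C}:\mathbf{CComon}\to\mathbf{Frob}$ is the evident embedding (copy to copy, discard to counit); $[\mathcal{I},\mathcal{C}]$ is their copairing. $[\![-]\!]:\mathbf{SMC}(\Sigma)+\mathbf{Frob}\to\mathrm{Csp}_D(\mathbf{Hyp}_\Sigma)$ sends $\phi:m\to n$ to $m\to E_\phi\leftarrow n$ where $E_\phi$ has $m+n$ vertices and one hyperedge labelled $\phi$ with sources the $m$ left-interface vertices and targets the $n$ right-interface vertices, and sends the Frobenius generators to the discrete cospans above. -}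

module Defs where

open import Level using (0ℓ)
open import Data.Nat using (ℕ; zero; suc; _+_)
open import Data.Nat.Properties using (+-assoc)
open import Data.Fin using (Fin; zero; suc; _↑ˡ_; _↑ʳ_; splitAt)
open import Data.Sum using (_⊎_; inj₁; inj₂; [_,_])
open import Data.Sum.Relation.Binary.Pointwise using (⊎-setoid)
open import Data.Product using (Σ; _,_)
open import Data.Unit using (⊤; tt)
open import Data.Empty using (⊥)
open import Relation.Nullary using (¬_)
open import Relation.Binary.Bundles using (Setoid)
open import Relation.Binary.PropositionalEquality as P using (_≡_; refl; subst₂)
import Relation.Binary.Construct.Closure.Equivalence as EqC

record Signature : Set₁ where
  field
    Gen   : Set
    ar    : Gen → ℕ
    coar  : Gen → ℕ

-- Vertices form a setoid: the actual vertex set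
-- is the quotient (this is how pushouts are represented without quotient
-- types).

module _ (Σg : Signature) where
  open Signature Σg

  record Hyp : Set₁ where
    field
      V    : Setoid 0ℓ 0ℓ
      E    : Set
      lab  : E → Gen
      src  : (e : E) → Fin (ar (lab e)) → Setoid.Carrier V
      tgt  : (e : E) → Fin (coar (lab e)) → Setoid.Carrier V

  -- cospans m → F ← n (a representative of the isomorphism class)
  record Cospan (m n : ℕ) : Set₁ where
    field
      apex  : Hyp
      left  : Fin m → Setoid.Carrier (Hyp.V apex)
      right : Fin n → Setoid.Carrier (Hyp.V apex)

  -- In-degree of v (in the quotient)
  -- counts pairs (e , j) with tgt e j ≈ v; "in-degree 0" means there is
  -- no such pair, "in-degree 0 or 1" means any two such pairs are equal.

  record PLM {m n : ℕ} (c : Cospan m n) : Set where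
    open Cospan c
    open Hyp apex
    open Setoid V renaming (Carrier to Vt)
    field
      left-injective : ∀ (i i' : Fin m) → left i ≈ left i' → i ≡ i'
      left-indeg0    : ∀ (i : Fin m) (e : E) (j : Fin (coar (lab e))) →
                       ¬ (tgt e j ≈ left i)
      indeg≤1        : ∀ (v : Vt) (e e' : E) (j : Fin (coar (lab e)))
                         (j' : Fin (coar (lab e'))) →
                       tgt e j ≈ v → tgt e' j' ≈ v →
                       _≡_ {A = Σ E (λ e → Fin (coar (lab e)))} (e , j) (e' , j')

  disc : ∀ {m n} k → (Fin m → Fin k) → (Fin n → Fin k) → Cospan m n
  disc k f g = record
    { apex = record { V = P.setoid (Fin k) ; E = ⊥ ; lab = λ () ; src = λ () ; tgt = λ () }
    ; left = f ; right = g }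

  genCsp : (g : Gen) → Cospan (ar g) (coar g)
  genCsp g = record
    { apex = record
        { V = P.setoid (Fin (ar g + coar g)) ; E = ⊤ ; lab = λ _ → g
        ; src = λ _ i → i ↑ˡ coar g ; tgt = λ _ j → ar g ↑ʳ j }
    ; left = λ i → i ↑ˡ coar g ; right = λ j → ar g ↑ʳ j }

  swapFin : ∀ m n → Fin (n + m) → Fin (m + n)
  swapFin m n i = [ (λ a → m ↑ʳ a) , (λ b → b ↑ˡ n) ] (splitAt n i)

  _⊗C_ : ∀ {m n p q} → Cospan m n → Cospan p q → Cospan (m + p) (n + q)
  _⊗C_ {m} {n} {p} {q} c d = record
    { apex = record
        { V = ⊎-setoid (Hyp.V (Cospan.apex c)) (Hyp.V (Cospan.apex d))
        ; E = Hyp.E (Cospan.apex c) ⊎ Hyp.E (Cospan.apex d)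
        ; lab = [ Hyp.lab (Cospan.apex c) , Hyp.lab (Cospan.apex d) ]
        ; src = λ { (inj₁ e) i → inj₁ (Hyp.src (Cospan.apex c) e i)
                  ; (inj₂ e) i → inj₂ (Hyp.src (Cospan.apex d) e i) }
        ; tgt = λ { (inj₁ e) j → inj₁ (Hyp.tgt (Cospan.apex c) e j)
                  ; (inj₂ e) j → inj₂ (Hyp.tgt (Cospan.apex d) e j) } }
    ; left  = λ i → [ (λ a → inj₁ (Cospan.left c a))  , (λ b → inj₂ (Cospan.left d b))  ] (splitAt m i)
    ; right = λ j → [ (λ a → inj₁ (Cospan.right c a)) , (λ b → inj₂ (Cospan.right d b)) ] (splitAt n j) }

  -- generating relation of the pushout of F ← n → G
  data Glue {n : ℕ} (c d : Hyp) (r : Fin n → Setoid.Carrier (Hyp.V c))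
            (l : Fin n → Setoid.Carrier (Hyp.V d)) :
            Setoid.Carrier (Hyp.V c) ⊎ Setoid.Carrier (Hyp.V d) →
            Setoid.Carrier (Hyp.V c) ⊎ Setoid.Carrier (Hyp.V d) → Set where
    inl  : ∀ {x y} → Setoid._≈_ (Hyp.V c) x y → Glue c d r l (inj₁ x) (inj₁ y)
    inr  : ∀ {x y} → Setoid._≈_ (Hyp.V d) x y → Glue c d r l (inj₂ x) (inj₂ y)
    glue : ∀ (i : Fin n) → Glue c d r l (inj₁ (r i)) (inj₂ (l i))

  _⨾C_ : ∀ {m n p} → Cospan m n → Cospan n p → Cospan m p
  c ⨾C d = record
    { apex = record
        { V = EqC.setoid (Glue (Cospan.apex c) (Cospan.apex d) (Cospan.right c) (Cospan.left d))
        ; E = Hyp.E (Cospan.apex c) ⊎ Hyp.E (Cospan.apex d)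
        ; lab = [ Hyp.lab (Cospan.apex c) , Hyp.lab (Cospan.apex d) ]
        ; src = λ { (inj₁ e) i → inj₁ (Hyp.src (Cospan.apex c) e i)
                  ; (inj₂ e) i → inj₂ (Hyp.src (Cospan.apex d) e i) }
        ; tgt = λ { (inj₁ e) j → inj₁ (Hyp.tgt (Cospan.apex c) e j)
                  ; (inj₂ e) j → inj₂ (Hyp.tgt (Cospan.apex d) e j) } }
    ; left = λ i → inj₁ (Cospan.left c i)
    ; right = λ j → inj₂ (Cospan.right d j) }

  -- Terms of SMC(Σ) + Frob (morphisms are classes of these terms)

  data FTm : ℕ → ℕ → Set where
    fgen   : (g : Gen) → FTm (ar g) (coar g)
    fid    : ∀ n → FTm n n
    fsym   : ∀ m n → FTm (m + n) (n + m)
    _⨾F_   : ∀ {m n p} → FTm m n → FTm n p → FTm m p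
    _⊗F_   : ∀ {m n p q} → FTm m n → FTm p q → FTm (m + p) (n + q)
    merge  : FTm 2 1
    unit   : FTm 0 1
    copy   : FTm 1 2
    counit : FTm 1 0

  castF : ∀ {m m' n n'} → m ≡ m' → n ≡ n' → FTm m n → FTm m' n'
  castF p q t = subst₂ FTm p q t

  cup1 : FTm 0 2
  cup1 = unit ⨾F copy

  cap1 : FTm 2 0
  cap1 = merge ⨾F counit

  -- cup_x : 0 → x + x and cap_x : x + x → 0 pairing wire i with wire x + i
  cup : ∀ x → FTm 0 (x + x)
  cup zero    = fid 0
  cup (suc x) = castF refl (P.cong suc (+-assoc x 1 x))
                  ((cup1 ⊗F cup x) ⨾F (fid 1 ⊗F (fsym 1 x ⊗F fid x)))

  cap : ∀ x → FTm (x + x) 0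
  cap zero    = fid 0
  cap (suc x) = castF (P.cong suc (+-assoc x 1 x)) refl
                  ((fid 1 ⊗F (fsym x 1 ⊗F fid x)) ⨾F (cap1 ⊗F cap x))

  canTr : ∀ {m n} x → FTm (x + m) (x + n) → FTm m n
  canTr {m} {n} x h =
    castF refl (+-assoc x x m) (cup x ⊗F fid m)
    ⨾F ((fid x ⊗F h)
    ⨾F castF (+-assoc x x n) refl (cap x ⊗F fid n))

  -- Terms of STMC(Σ) + CComon (morphisms are classes of these terms)

  data TTm : ℕ → ℕ → Set where
    tgen    : (g : Gen) → TTm (ar g) (coar g)
    tid     : ∀ n → TTm n n
    tsym    : ∀ m n → TTm (m + n) (n + m)
    _⨾T_    : ∀ {m n p} → TTm m n → TTm n p → TTm m p
    _⊗T_    : ∀ {m n p q} → TTm m n → TTm p q → TTm (m + p) (n + q)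
    trace   : ∀ {m n} x → TTm (x + m) (x + n) → TTm m n
    tcopy   : TTm 1 2
    discard : TTm 1 0

  IC : ∀ {m n} → TTm m n → FTm m n
  IC (tgen g)    = fgen g
  IC (tid n)     = fid n
  IC (tsym m n)  = fsym m n
  IC (s ⨾T t)    = IC s ⨾F IC t
  IC (s ⊗T t)    = IC s ⊗F IC t
  IC (trace x t) = canTr x (IC t)
  IC tcopy       = copy
  IC discard     = counit

  ⟦_⟧ : ∀ {m n} → FTm m n → Cospan m n
  ⟦ fgen g ⟧   = genCsp g
  ⟦ fid n ⟧    = disc n (λ i → i) (λ i → i)
  ⟦ fsym m n ⟧ = disc (m + n) (λ i → i) (swapFin m n)
  ⟦ s ⨾F t ⟧   = ⟦ s ⟧ ⨾C ⟦ t ⟧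
  ⟦ s ⊗F t ⟧   = ⟦ s ⟧ ⊗C ⟦ t ⟧
  ⟦ merge ⟧    = disc 1 (λ _ → zero) (λ _ → zero)
  ⟦ unit ⟧     = disc 1 (λ ()) (λ _ → zero)
  ⟦ copy ⟧     = disc 1 (λ _ → zero) (λ _ → zero)
  ⟦ counit ⟧   = disc 1 (λ _ → zero) (λ ())

-- Colour each vertex of a cospan by what drives it: a left-interface vertex,
-- a hyperedge output, or a default colour (for a loop made only of wires).  For
-- every traced term such a colouring exists whatever colours are prescribed on
-- the left interface and on the hyperedge outputs: it is built piecewise along
-- composition and tensor, and for the canonical trace the colours of the
-- fed-back wires are obtained by solving the wire-to-wire equations that the
-- traced term induces.  Giving each left-interface vertex and each hyperedge
-- output a distinct colour, equal colours force equal drivers, which is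
-- partial left-monogamy.
module Submission where

open import Defs
open import Data.Nat using (ℕ; zero; suc; _+_)
open import Data.Nat.Properties using (+-assoc)
open import Data.Fin using (Fin; zero; suc; _↑ˡ_; _↑ʳ_; splitAt; cast; toℕ)
open import Data.Fin.Properties
  using (toℕ-injective; toℕ-cast; toℕ-↑ˡ; toℕ-↑ʳ; cast-is-id; join-splitAt)
open import Data.Vec.Functional using (Vector; []; _∷_; _++_; head; tail; replicate)
open import Data.Vec.Functional.Properties using (lookup-++ˡ; lookup-++ʳ; ++-cong)
open import Data.Sum using (_⊎_; inj₁; inj₂; [_,_])
open import Data.Sum.Properties using ([,]-∘; [,]-map; [,]-cong; inj₁-injective; inj₂-injective)
open import Data.Sum.Relation.Binary.Pointwise using (inj₁; inj₂)
open import Data.Maybe using (just; nothing)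
open import Data.Maybe.Properties using (just-injective)
open import Data.Product using (Σ; ∃; _,_; proj₁; proj₂)
open import Data.Unit using (tt)
open import Function using (_∘_; id)
open import Function.Definitions using (Injective)
open import Relation.Binary.Bundles using (Setoid)
open import Relation.Binary.PropositionalEquality
  using (_≡_; _≢_; _≗_; refl; sym; trans; cong; isEquivalence; module ≡-Reasoning)
import Relation.Binary.Construct.Closure.Equivalence as EqClosure

private
  variable
    A : Set
    m n : ℕ

-- Each unknown is defined by another unknown or by a constant.  Unknown 0 is
-- eliminated by substitution; an unknown that ends up defined by itself gets y.
feedback-solution : ∀ x {Y : Set} → Y → (f : Fin x → Fin x ⊎ Y) →
                    ∃ λ (g : Fin x → Y) → g ≗ [ g , id ] ∘ f
feedback-solution zero    y f = (λ ()) , λ ()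
feedback-solution (suc x) {Y} y f = g , solves
  where
  subst₀ : Fin x ⊎ Y → Fin (suc x) ⊎ Y → Fin x ⊎ Y
  subst₀ d (inj₁ zero)    = d
  subst₀ d (inj₁ (suc k)) = inj₁ k
  subst₀ d (inj₂ v)       = inj₂ v

  d₀ : Fin x ⊎ Y
  d₀ = subst₀ (inj₂ y) (f zero)

  rest = feedback-solution x y (subst₀ d₀ ∘ f ∘ suc)

  g′ : Fin x → Y
  g′ = proj₁ rest

  g : Fin (suc x) → Y
  g = [ g′ , id ] d₀ ∷ g′

  subst₀-sound : ∀ w → [ g′ , id ] (subst₀ d₀ w) ≡ [ g , id ] w
  subst₀-sound (inj₁ zero)    = refl
  subst₀-sound (inj₁ (suc k)) = refl
  subst₀-sound (inj₂ v)       = refl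

  self-loop-sound : ∀ w → [ g′ , id ] (subst₀ (inj₂ y) w)
                        ≡ [ [ g′ , id ] (subst₀ (inj₂ y) w) ∷ g′ , id ] w
  self-loop-sound (inj₁ zero)    = refl
  self-loop-sound (inj₁ (suc k)) = refl
  self-loop-sound (inj₂ v)       = refl

  solves : g ≗ [ g , id ] ∘ f
  solves zero    = self-loop-sound (f zero)
  solves (suc k) = trans (proj₂ rest k) (subst₀-sound (f (suc k)))

++-split : ∀ m {n} (xs : Vector A (m + n)) → (xs ∘ (_↑ˡ n)) ++ (xs ∘ (m ↑ʳ_)) ≗ xs
++-split m {n} xs i = trans (sym ([,]-∘ xs (splitAt m i))) (cong xs (join-splitAt m n i))

≗-split : ∀ m {n} {xs ys : Vector A (m + n)} →
          xs ∘ (_↑ˡ n) ≗ ys ∘ (_↑ˡ n) → xs ∘ (m ↑ʳ_) ≗ ys ∘ (m ↑ʳ_) → xs ≗ ys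
≗-split m {n} {xs} {ys} eqˡ eqʳ i = begin
  xs i                                   ≡⟨ ++-split m xs i ⟨
  ((xs ∘ (_↑ˡ n)) ++ (xs ∘ (m ↑ʳ_))) i   ≡⟨ ++-cong _ _ eqˡ eqʳ i ⟩
  ((ys ∘ (_↑ˡ n)) ++ (ys ∘ (m ↑ʳ_))) i   ≡⟨ ++-split m ys i ⟩
  ys i                                   ∎
  where open ≡-Reasoning

++-suc : ∀ (xs : Vector A (suc m)) (ys : Vector A n) i → (xs ++ ys) (suc i) ≡ (tail xs ++ ys) i
++-suc {m = m} xs ys i = [,]-map (splitAt m i)

head-++-tail : ∀ (xs : Vector A (suc m)) → replicate 1 (head xs) ++ tail xs ≗ xs
head-++-tail xs zero    = refl
head-++-tail xs (suc i) = refl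

cast-≡ : ∀ .(p : m ≡ n) {i : Fin m} {j : Fin n} → toℕ i ≡ toℕ j → cast p i ≡ j
cast-≡ p {i} e = toℕ-injective (trans (toℕ-cast p i) e)

cast-assoc-↑ˡ-↑ˡ : ∀ l m n (i : Fin l) → cast (+-assoc l m n) ((i ↑ˡ m) ↑ˡ n) ≡ i ↑ˡ (m + n)
cast-assoc-↑ˡ-↑ˡ l m n i = cast-≡ (+-assoc l m n) (begin
  toℕ ((i ↑ˡ m) ↑ˡ n)  ≡⟨ toℕ-↑ˡ (i ↑ˡ m) n ⟩
  toℕ (i ↑ˡ m)         ≡⟨ toℕ-↑ˡ i m ⟩
  toℕ i                ≡⟨ toℕ-↑ˡ i (m + n) ⟨
  toℕ (i ↑ˡ (m + n))   ∎)
  where open ≡-Reasoning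

cast-assoc-↑ʳ-↑ˡ : ∀ l m n (i : Fin m) → cast (+-assoc l m n) ((l ↑ʳ i) ↑ˡ n) ≡ l ↑ʳ (i ↑ˡ n)
cast-assoc-↑ʳ-↑ˡ l m n i = cast-≡ (+-assoc l m n) (begin
  toℕ ((l ↑ʳ i) ↑ˡ n)  ≡⟨ toℕ-↑ˡ (l ↑ʳ i) n ⟩
  toℕ (l ↑ʳ i)         ≡⟨ toℕ-↑ʳ l i ⟩
  l + toℕ i            ≡⟨ cong (l +_) (toℕ-↑ˡ i n) ⟨
  l + toℕ (i ↑ˡ n)     ≡⟨ toℕ-↑ʳ l (i ↑ˡ n) ⟨
  toℕ (l ↑ʳ (i ↑ˡ n))  ∎)
  where open ≡-Reasoning

cast-assoc-↑ʳ : ∀ l m n (k : Fin n) → cast (+-assoc l m n) ((l + m) ↑ʳ k) ≡ l ↑ʳ (m ↑ʳ k)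
cast-assoc-↑ʳ l m n k = cast-≡ (+-assoc l m n) (begin
  toℕ ((l + m) ↑ʳ k)   ≡⟨ toℕ-↑ʳ (l + m) k ⟩
  l + m + toℕ k        ≡⟨ +-assoc l m (toℕ k) ⟩
  l + (m + toℕ k)      ≡⟨ cong (l +_) (toℕ-↑ʳ m k) ⟨
  l + toℕ (m ↑ʳ k)     ≡⟨ toℕ-↑ʳ l (m ↑ʳ k) ⟨
  toℕ (l ↑ʳ (m ↑ʳ k))  ∎)
  where open ≡-Reasoning

++-assoc : ∀ l m {n} (xs : Vector A l) (ys : Vector A m) (zs : Vector A n) →
           (xs ++ ys) ++ zs ≗ (xs ++ (ys ++ zs)) ∘ cast (+-assoc l m n)
++-assoc l m {n} xs ys zs = ≗-split (l + m) (≗-split l onXs onYs) onZs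
  where
  open ≡-Reasoning
  lhs : Vector _ (l + m + n)
  lhs = (xs ++ ys) ++ zs
  rhs : Vector _ (l + (m + n))
  rhs = xs ++ (ys ++ zs)

  onXs : ∀ i → lhs ((i ↑ˡ m) ↑ˡ n) ≡ rhs (cast (+-assoc l m n) ((i ↑ˡ m) ↑ˡ n))
  onXs i = begin
    lhs ((i ↑ˡ m) ↑ˡ n)    ≡⟨ lookup-++ˡ (xs ++ ys) zs (i ↑ˡ m) ⟩
    (xs ++ ys) (i ↑ˡ m)    ≡⟨ lookup-++ˡ xs ys i ⟩
    xs i                   ≡⟨ lookup-++ˡ xs (ys ++ zs) i ⟨
    rhs (i ↑ˡ (m + n))     ≡⟨ cong rhs (cast-assoc-↑ˡ-↑ˡ l m n i) ⟨
    rhs (cast (+-assoc l m n) ((i ↑ˡ m) ↑ˡ n)) ∎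
  onYs : ∀ i → lhs ((l ↑ʳ i) ↑ˡ n) ≡ rhs (cast (+-assoc l m n) ((l ↑ʳ i) ↑ˡ n))
  onYs i = begin
    lhs ((l ↑ʳ i) ↑ˡ n)    ≡⟨ lookup-++ˡ (xs ++ ys) zs (l ↑ʳ i) ⟩
    (xs ++ ys) (l ↑ʳ i)    ≡⟨ lookup-++ʳ xs ys i ⟩
    ys i                   ≡⟨ lookup-++ˡ ys zs i ⟨
    (ys ++ zs) (i ↑ˡ n)    ≡⟨ lookup-++ʳ xs (ys ++ zs) (i ↑ˡ n) ⟨
    rhs (l ↑ʳ (i ↑ˡ n))    ≡⟨ cong rhs (cast-assoc-↑ʳ-↑ˡ l m n i) ⟨
    rhs (cast (+-assoc l m n) ((l ↑ʳ i) ↑ˡ n)) ∎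
  onZs : ∀ k → lhs ((l + m) ↑ʳ k) ≡ rhs (cast (+-assoc l m n) ((l + m) ↑ʳ k))
  onZs k = begin
    lhs ((l + m) ↑ʳ k)     ≡⟨ lookup-++ʳ (xs ++ ys) zs k ⟩
    zs k                   ≡⟨ lookup-++ʳ ys zs k ⟨
    (ys ++ zs) (m ↑ʳ k)    ≡⟨ lookup-++ʳ xs (ys ++ zs) (m ↑ʳ k) ⟨
    rhs (l ↑ʳ (m ↑ʳ k))    ≡⟨ cong rhs (cast-assoc-↑ʳ l m n k) ⟨
    rhs (cast (+-assoc l m n) ((l + m) ↑ʳ k)) ∎

++-self-rotate : ∀ x (g : Vector A (suc x)) →
                 (g ++ g) ∘ cast (cong suc (+-assoc x 1 x))
                   ≗ replicate 1 (head g) ++ ((tail g ++ replicate 1 (head g)) ++ tail g)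
++-self-rotate x g zero    = refl
++-self-rotate x g (suc k) = begin
  (g ++ g) (suc (cast p k))                 ≡⟨ ++-suc g g (cast p k) ⟩
  (tail g ++ g) (cast p k)                  ≡⟨ ++-cong _ _ (λ _ → refl) (head-++-tail g) (cast p k) ⟨
  (tail g ++ ([ v ] ++ tail g)) (cast p k)  ≡⟨ ++-assoc x 1 (tail g) [ v ] (tail g) k ⟨
  ((tail g ++ [ v ]) ++ tail g) k           ∎
  where
  open ≡-Reasoning
  p = +-assoc x 1 x
  v = head g
  [_] = replicate 1

replicate-2-++ : ∀ (v : A) (xs : Vector A m) (ys : Vector A n) →
                 replicate 2 v ++ (xs ++ ys) ≗ replicate 1 v ++ ((replicate 1 v ++ xs) ++ ys)
replicate-2-++ v xs ys zero          = refl
replicate-2-++ v xs ys (suc zero)    = refl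
replicate-2-++ v xs ys (suc (suc k)) = sym (++-suc (replicate 1 v ++ xs) ys k)

module _ (Σg : Signature) where
  open Signature Σg
  open Cospan
  open Hyp

  Port : Cospan Σg m n → Set
  Port c = Σ (E (apex c)) λ e → Fin (coar (lab (apex c) e))

  record Colouring (c : Cospan Σg m n) {X : Set}
                   (ρ : Vector X m) (σ : Vector X n) (τ : Port c → X) : Set where
    open Setoid (V (apex c))
    field
      colour       : Carrier → X
      colour-cong  : ∀ {u v} → u ≈ v → colour u ≡ colour v
      colour-left  : ∀ i → colour (left c i) ≡ ρ i
      colour-right : ∀ j → colour (right c j) ≡ σ j
      colour-tgt   : ∀ e j → colour (tgt (apex c) e j) ≡ τ (e , j)
  open Colouring

  module _ {X : Set} where

    relabel : ∀ {c : Cospan Σg m n} {ρ ρ′ : Vector X m} {σ σ′ : Vector X n} {τ} →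
              ρ ≗ ρ′ → σ ≗ σ′ → Colouring c ρ σ τ → Colouring c ρ′ σ′ τ
    relabel eqρ eqσ C = record
      { colour       = colour C
      ; colour-cong  = colour-cong C
      ; colour-left  = λ i → trans (colour-left C i) (eqρ i)
      ; colour-right = λ j → trans (colour-right C j) (eqσ j)
      ; colour-tgt   = colour-tgt C
      }

    map-colouring : ∀ {Y : Set} {c : Cospan Σg m n} {ρ σ τ} (φ : X → Y) →
                    Colouring c ρ σ τ → Colouring c (φ ∘ ρ) (φ ∘ σ) (φ ∘ τ)
    map-colouring φ C = record
      { colour       = φ ∘ colour C
      ; colour-cong  = cong φ ∘ colour-cong C
      ; colour-left  = cong φ ∘ colour-left C
      ; colour-right = cong φ ∘ colour-right C
      ; colour-tgt   = λ e j → cong φ (colour-tgt C e j)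
      }

    disc-colouring : ∀ k (f : Fin m → Fin k) (g : Fin n → Fin k) (δ : Vector X k) {τ} →
                     Colouring (disc Σg k f g) (δ ∘ f) (δ ∘ g) τ
    disc-colouring k f g δ = record
      { colour = δ ; colour-cong = cong δ ; colour-left = λ _ → refl
      ; colour-right = λ _ → refl ; colour-tgt = λ () }

    gen-colouring : ∀ (g : Gen) (ρ : Vector X (ar g)) τ →
                    Colouring (genCsp Σg g) ρ (λ j → τ (tt , j)) τ
    gen-colouring g ρ τ = record
      { colour       = ρ ++ τ′
      ; colour-cong  = cong (ρ ++ τ′)
      ; colour-left  = lookup-++ˡ ρ τ′
      ; colour-right = lookup-++ʳ ρ τ′
      ; colour-tgt   = λ _ → lookup-++ʳ ρ τ′
      }
      where τ′ = λ j → τ (tt , j)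

    ⨾-colouring : ∀ {p} {c : Cospan Σg m n} {d : Cospan Σg n p} {ρ σ υ}
                  {τ : Port (_⨾C_ Σg c d) → X} →
                  Colouring c ρ σ (λ (e , j) → τ (inj₁ e , j)) →
                  Colouring d σ υ (λ (e , j) → τ (inj₂ e , j)) →
                  Colouring (_⨾C_ Σg c d) ρ υ τ
    ⨾-colouring {c = c} {d} C D = record
      { colour       = [ colour C , colour D ]
      ; colour-cong  = EqClosure.gfold isEquivalence [ colour C , colour D ] glue-respected
      ; colour-left  = colour-left C
      ; colour-right = colour-right D
      ; colour-tgt   = λ { (inj₁ e) → colour-tgt C e ; (inj₂ e) → colour-tgt D e }
      }
      where
      glue-respected : ∀ {u v} → Glue Σg (apex c) (apex d) (right c) (left d) u v →
                       [ colour C , colour D ] u ≡ [ colour C , colour D ] v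
      glue-respected (inl r)  = colour-cong C r
      glue-respected (inr r)  = colour-cong D r
      glue-respected (glue i) = trans (colour-right C i) (sym (colour-left D i))

    ⊗-colouring : ∀ {p q} {c : Cospan Σg m n} {d : Cospan Σg p q} {ρ₁ σ₁ ρ₂ σ₂}
                  {τ : Port (_⊗C_ Σg c d) → X} →
                  Colouring c ρ₁ σ₁ (λ (e , j) → τ (inj₁ e , j)) →
                  Colouring d ρ₂ σ₂ (λ (e , j) → τ (inj₂ e , j)) →
                  Colouring (_⊗C_ Σg c d) (ρ₁ ++ ρ₂) (σ₁ ++ σ₂) τ
    ⊗-colouring {m} {n} C D = record
      { colour       = [ colour C , colour D ]
      ; colour-cong  = λ { (inj₁ r) → colour-cong C r ; (inj₂ r) → colour-cong D r }
      ; colour-left  = λ i → trans ([,]-∘ [ colour C , colour D ] (splitAt m i))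
                                   ([,]-cong (colour-left C) (colour-left D) (splitAt m i))
      ; colour-right = λ j → trans ([,]-∘ [ colour C , colour D ] (splitAt n j))
                                   ([,]-cong (colour-right C) (colour-right D) (splitAt n j))
      ; colour-tgt   = λ { (inj₁ e) → colour-tgt C e ; (inj₂ e) → colour-tgt D e }
      }

    cast-colouring : ∀ {m′ n′} (p : m ≡ m′) (q : n ≡ n′) (t : FTm Σg m n)
                     {ρ : Vector X m′} {σ : Vector X n′} →
                     (∀ {τ} → Colouring (⟦_⟧ Σg t) (ρ ∘ cast p) (σ ∘ cast q) τ) →
                     ∀ {τ} → Colouring (⟦_⟧ Σg (castF Σg p q t)) ρ σ τ
    cast-colouring refl refl t {ρ} {σ} C =
      relabel (cong ρ ∘ cast-is-id refl) (cong σ ∘ cast-is-id refl) C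

    id-colouring : ∀ {ρ : Vector X n} {τ} → Colouring (⟦_⟧ Σg (fid n)) ρ ρ τ
    id-colouring {n} {ρ} = disc-colouring n id id ρ

    sym-colouring : ∀ m n {xs : Vector X m} {ys : Vector X n} {τ} →
                    Colouring (⟦_⟧ Σg (fsym m n)) (xs ++ ys) (ys ++ xs) τ
    sym-colouring m n {xs} {ys} =
      relabel (λ _ → refl) ++-swap (disc-colouring (m + n) id (swapFin Σg m n) (xs ++ ys))
      where
      ++-swap : (xs ++ ys) ∘ swapFin Σg m n ≗ ys ++ xs
      ++-swap i with splitAt n i
      ... | inj₁ a = lookup-++ʳ xs ys a
      ... | inj₂ b = lookup-++ˡ xs ys b

    cup1-colouring : ∀ (v : X) {τ} → Colouring (⟦_⟧ Σg (cup1 Σg)) [] (replicate 2 v) τ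
    cup1-colouring v =
      ⨾-colouring (relabel (λ ()) (λ _ → refl) (disc-colouring 1 (λ ()) (λ _ → zero) (replicate 1 v)))
                  (disc-colouring 1 (λ _ → zero) (λ _ → zero) (replicate 1 v))

    cap1-colouring : ∀ (v : X) {τ} → Colouring (⟦_⟧ Σg (cap1 Σg)) (replicate 2 v) [] τ
    cap1-colouring v =
      ⨾-colouring (disc-colouring 1 (λ _ → zero) (λ _ → zero) (replicate 1 v))
                  (relabel (λ _ → refl) (λ ()) (disc-colouring 1 (λ _ → zero) (λ ()) (replicate 1 v)))

    cup-colouring : ∀ x (g : Vector X x) {τ} → Colouring (⟦_⟧ Σg (cup Σg x)) [] (g ++ g) τ
    cup-colouring zero    g = relabel (λ ()) (λ ()) (id-colouring {ρ = []})
    cup-colouring (suc x) g =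
      cast-colouring refl (cong suc (+-assoc x 1 x))
        ((cup1 Σg ⊗F cup Σg x) ⨾F (fid 1 ⊗F (fsym 1 x ⊗F fid x)))
      (relabel (λ ()) (sym ∘ ++-self-rotate x g)
        (⨾-colouring
          (relabel (λ _ → refl) (replicate-2-++ (head g) (tail g) (tail g))
            (⊗-colouring (cup1-colouring (head g)) (cup-colouring x (tail g))))
          (⊗-colouring id-colouring (⊗-colouring (sym-colouring 1 x) id-colouring))))

    cap-colouring : ∀ x (g : Vector X x) {τ} → Colouring (⟦_⟧ Σg (cap Σg x)) (g ++ g) [] τ
    cap-colouring zero    g = relabel (λ ()) (λ ()) (id-colouring {ρ = []})
    cap-colouring (suc x) g =
      cast-colouring (cong suc (+-assoc x 1 x)) refl
        ((fid 1 ⊗F (fsym x 1 ⊗F fid x)) ⨾F (cap1 Σg ⊗F cap Σg x))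
      (relabel (sym ∘ ++-self-rotate x g) (λ ())
        (⨾-colouring
          (⊗-colouring id-colouring (⊗-colouring (sym-colouring x 1) id-colouring))
          (relabel (replicate-2-++ (head g) (tail g) (tail g)) (λ _ → refl)
            (⊗-colouring (cap1-colouring (head g)) (cap-colouring x (tail g))))))

    cup⊗id-colouring : ∀ x (g : Vector X x) (ρ : Vector X m) {τ} →
      Colouring (⟦_⟧ Σg (castF Σg refl (+-assoc x x m) (cup Σg x ⊗F fid m))) ρ (g ++ (g ++ ρ)) τ
    cup⊗id-colouring {m} x g ρ =
      cast-colouring refl (+-assoc x x m) (cup Σg x ⊗F fid m)
        (relabel (cong ρ ∘ sym ∘ cast-is-id refl) (++-assoc x x g g ρ)
          (⊗-colouring (cup-colouring x g) id-colouring))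

    cap⊗id-colouring : ∀ x (g : Vector X x) (w : Vector X (x + n)) → w ∘ (_↑ˡ n) ≗ g → ∀ {τ} →
      Colouring (⟦_⟧ Σg (castF Σg (+-assoc x x n) refl (cap Σg x ⊗F fid n))) (g ++ w) (w ∘ (x ↑ʳ_)) τ
    cap⊗id-colouring {n} x g w w≗g =
      cast-colouring (+-assoc x x n) refl (cap Σg x ⊗F fid n)
        (relabel left-reassoc (cong (w ∘ (x ↑ʳ_)) ∘ sym ∘ cast-is-id refl)
          (⊗-colouring (cap-colouring x g) id-colouring))
      where
      g++w≗w : g ++ (w ∘ (x ↑ʳ_)) ≗ w
      g++w≗w i = trans (++-cong _ _ (sym ∘ w≗g) (λ _ → refl) i) (++-split x w i)

      left-reassoc : (g ++ g) ++ (w ∘ (x ↑ʳ_)) ≗ (g ++ w) ∘ cast (+-assoc x x n)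
      left-reassoc i = trans (++-assoc x x g g _ i) (++-cong g g (λ _ → refl) g++w≗w _)

  Colourable : FTm Σg m n → Set₁
  Colourable {m} {n} t = ∀ {X : Set} → X → (ρ : Vector X m) (τ : Port (⟦_⟧ Σg t) → X) →
                         ∃ λ σ → Colouring (⟦_⟧ Σg t) ρ σ τ

  -- Colour the fed-back wires by Fin x: the output of h on them then tells,
  -- for each such wire, which fed-back wire or colour drives it.
  canTr-colourable : ∀ x (h : FTm Σg (x + m) (x + n)) → Colourable h → Colourable (canTr Σg x h)
  canTr-colourable {m} {n} x h h-colourable {X} y ρ τ =
    w ∘ (x ↑ʳ_) ,
    ⨾-colouring (cup⊗id-colouring x g ρ)
      (⨾-colouring
        (⊗-colouring id-colouring
          (relabel (λ i → [,]-∘ resolve (splitAt x i)) (λ _ → refl)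
            (map-colouring resolve (proj₂ inner))))
        (cap⊗id-colouring x g w (sym ∘ proj₂ feedback)))
    where
    inner : ∃ λ σ → Colouring (⟦_⟧ Σg h) (inj₁ ++ (inj₂ ∘ ρ)) σ
                                (λ (e , j) → inj₂ (τ (inj₂ (inj₁ (inj₂ e)) , j)))
    inner = h-colourable (inj₂ y) (inj₁ ++ (inj₂ ∘ ρ)) _

    feedback = feedback-solution x y (proj₁ inner ∘ (_↑ˡ n))

    g : Vector X x
    g = proj₁ feedback

    resolve : Fin x ⊎ X → X
    resolve = [ g , id ]

    w : Vector X (x + n)
    w = resolve ∘ proj₁ inner

  colourable : ∀ (t : TTm Σg m n) → Colourable (IC Σg t)
  colourable (tgen g)    y ρ τ = _ , gen-colouring g ρ τ
  colourable (tid n)     y ρ τ = ρ , id-colouring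
  colourable (tsym m n)  y ρ τ = _ , disc-colouring (m + n) id (swapFin Σg m n) ρ
  colourable (s ⨾T t)    y ρ τ =
    let σ , S = colourable s y ρ _
        υ , T = colourable t y σ _
    in υ , ⨾-colouring S T
  colourable (_⊗T_ {m} s t) y ρ τ =
    let σ₁ , S = colourable s y (ρ ∘ (_↑ˡ _)) _
        σ₂ , T = colourable t y (ρ ∘ (m ↑ʳ_)) _
    in σ₁ ++ σ₂ , relabel (++-split m ρ) (λ _ → refl) (⊗-colouring S T)
  colourable (trace x t) = canTr-colourable x (IC Σg t) (colourable t)
  colourable tcopy       y ρ τ =
    replicate 2 (ρ zero) ,
    relabel (λ { zero → refl }) (λ _ → refl)
      (disc-colouring 1 (λ _ → zero) (λ _ → zero) (replicate 1 (ρ zero)))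
  colourable discard     y ρ τ =
    [] ,
    relabel (λ { zero → refl }) (λ ()) (disc-colouring 1 (λ _ → zero) (λ ()) (replicate 1 (ρ zero)))

  separating-colouring⇒PLM : ∀ {c : Cospan Σg m n} {X} {ρ : Vector X m} {σ τ} →
    Injective _≡_ _≡_ ρ → Injective _≡_ _≡_ τ → (∀ p i → τ p ≢ ρ i) →
    Colouring c ρ σ τ → PLM Σg c
  separating-colouring⇒PLM ρ-injective τ-injective τ≢ρ C = record
    { left-injective = λ i i′ r →
        ρ-injective (trans (sym (colour-left C i)) (trans (colour-cong C r) (colour-left C i′)))
    ; left-indeg0    = λ i e j r →
        τ≢ρ (e , j) i (trans (sym (colour-tgt C e j)) (trans (colour-cong C r) (colour-left C i)))
    ; indeg≤1        = λ v e e′ j j′ r r′ →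
        τ-injective (trans (sym (colour-tgt C e j))
                    (trans (colour-cong C r) (trans (sym (colour-cong C r′)) (colour-tgt C e′ j′))))
    }

corollary4p12 : (Σg : Signature) {m n : ℕ} (t : TTm Σg m n) → PLM Σg (⟦_⟧ Σg (IC Σg t))
corollary4p12 Σg t =
  separating-colouring⇒PLM Σg (inj₁-injective ∘ just-injective) (inj₂-injective ∘ just-injective)
    (λ _ _ ()) (proj₂ (colourable Σg t nothing (just ∘ inj₁) (just ∘ inj₂)))
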